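{- Let $G$ be a graph and $M$ a matching of $G$ such that (i) every edge of $G$ is covered by exactly one edge of $M$, and (ii) whenever $e_1,e_2\in E(G)$ are both covered by the same edge $e_0\in M$, $e_1$ covers $e_2$. Then $G$ is well-indumatched.
   Context: All graphs are finite, simple and undirected. A matching is a set of edges no two of which share an endpoint. An induced matching of $G$ is a matching $M$ such that no edge of $G$ joins endpoints of two different edges of $M$. A graph is well-indumatched if all of its inclusion-wise maximal induced matchings have the same size. The distance between two edges $e_1,e_2$ is the minimum distance between an endpoint of $e_1$ and an endpoint of $e_2$; $e_1$ covers $e_2$ if this distance is at most $1$ (in particular every edge covers itself). -}

module Defs where

open import Data.Nat using (ℕ)
open import Data.Fin using (Fin; _<_)
open import Data.Product using (Σ; ∃; _×_; _,_; proj₁; proj₂)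
open import Data.Sum using (_⊎_)
open import Data.List using (List; length)
open import Data.List.Membership.Propositional using (_∈_)
open import Data.List.Relation.Binary.Subset.Propositional using (_⊆_)
open import Data.List.Relation.Unary.All using (All)
open import Data.List.Relation.Unary.Unique.Propositional using (Unique)
open import Relation.Binary.PropositionalEquality using (_≡_; _≢_)
open import Relation.Nullary using (¬_)
open import Level using (0ℓ; suc)

record Graph (n : ℕ) : Set₁ where
  field
    Adj   : Fin n → Fin n → Set
    sym   : ∀ {x y} → Adj x y → Adj y x
    irrefl : ∀ {x} → ¬ Adj x x

open Graph public

-- An edge {u,v} is represented by the ordered pair (u , v) with u < v.
Pair : ℕ → Set
Pair n = Fin n × Fin n

IsEdge : ∀ {n} → Graph n → Pair n → Set
IsEdge G (u , v) = (u < v) × Adj G u v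

_isEndOf_ : ∀ {n} → Fin n → Pair n → Set
x isEndOf (u , v) = (x ≡ u) ⊎ (x ≡ v)

Near : ∀ {n} → Graph n → Fin n → Fin n → Set
Near G x y = (x ≡ y) ⊎ Adj G x y

-- e₁ covers e₂: the distance between e₁ and e₂ is at most 1
Covers : ∀ {n} → Graph n → Pair n → Pair n → Set
Covers G e₁ e₂ = Σ _ λ x → Σ _ λ y → x isEndOf e₁ × y isEndOf e₂ × Near G x y

IsEdgeSet : ∀ {n} → Graph n → List (Pair n) → Set
IsEdgeSet G M = All (IsEdge G) M × Unique M

IsMatching : ∀ {n} → Graph n → List (Pair n) → Set
IsMatching G M = IsEdgeSet G M ×
  (∀ {e f} → e ∈ M → f ∈ M → e ≢ f →
     ∀ x → x isEndOf e → ¬ (x isEndOf f))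

IsInducedMatching : ∀ {n} → Graph n → List (Pair n) → Set
IsInducedMatching G M = IsMatching G M ×
  (∀ {e f} → e ∈ M → f ∈ M → e ≢ f →
     ∀ x y → x isEndOf e → y isEndOf f → ¬ Adj G x y)

IsMaximalInducedMatching : ∀ {n} → Graph n → List (Pair n) → Set
IsMaximalInducedMatching G M = IsInducedMatching G M ×
  (∀ M' → IsInducedMatching G M' → M ⊆ M' → M' ⊆ M)

WellIndumatched : ∀ {n} → Graph n → Set
WellIndumatched G = ∀ M M' → IsMaximalInducedMatching G M →
  IsMaximalInducedMatching G M' → length M ≡ length M'

CoveredExactlyOnce : ∀ {n} → Graph n → List (Pair n) → Set
CoveredExactlyOnce G M = ∀ e → IsEdge G e →
  (Σ _ λ f → f ∈ M × Covers G f e) ×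
  (∀ f f' → f ∈ M → f' ∈ M → Covers G f e → Covers G f' e → f ≡ f')

CoveredTogether : ∀ {n} → Graph n → List (Pair n) → Set
CoveredTogether G M = ∀ e₀ e₁ e₂ → e₀ ∈ M → IsEdge G e₁ → IsEdge G e₂ →
  Covers G e₀ e₁ → Covers G e₀ e₂ → Covers G e₁ e₂

-- Fix a maximal induced matching N. Sending each edge of N to the unique edge of M covering it
-- is injective: two edges of N covered by the same edge of M would cover each other by (ii),
-- which an induced matching forbids. Conversely every f ∈ M covers some edge of N, since
-- otherwise f could be added to N; sending f to such an edge is injective by (i). Hence
-- |N| = |M| for every maximal induced matching N.
module Submission where

open import Defs
open import Data.Nat using (_≤_; _≤?_)
open import Data.Nat.Properties using (≤-antisym)
open import Data.Fin using (Fin; zero; suc)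
import Data.Fin as Fin
open import Data.Fin.Properties using (injective⇒≤)
open import Data.List using (List; _∷_; length; lookup)
open import Data.List.Membership.Propositional using (_∈_)
open import Data.List.Membership.Propositional.Properties using (∈-lookup)
open import Data.List.Membership.Setoid.Properties using (index-injective)
open import Data.List.Relation.Unary.Any using (here; there; index)
open import Data.List.Relation.Unary.All as All using (All)
open import Data.List.Relation.Unary.Unique.Propositional using (Unique)
open import Data.List.Relation.Unary.AllPairs using (_∷_)
open import Data.Product using (∃-syntax; _×_; _,_; proj₁; proj₂)
open import Data.Product.Properties using (≡-dec)
open import Data.Sum using (inj₁; inj₂)
open import Effect.Monad using (RawMonad)
open import Level using (0ℓ)
open import Relation.Nullary using (¬_; yes; no; contradiction)
open import Relation.Nullary.Decidable using (decidable-stable)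
open import Relation.Nullary.Negation using (¬¬-Monad)
open import Relation.Binary.PropositionalEquality as ≡
  using (_≡_; _≢_; refl; trans; cong; setoid)

unique⇒lookup-injective : ∀ {A : Set} {xs : List A} → Unique xs →
                          ∀ i j → lookup xs i ≡ lookup xs j → i ≡ j
unique⇒lookup-injective (x∉ ∷ _) zero    zero    _  = refl
unique⇒lookup-injective (x∉ ∷ _) zero    (suc j) eq = contradiction eq (All.lookup x∉ (∈-lookup j))
unique⇒lookup-injective (x∉ ∷ _) (suc i) zero    eq = contradiction (≡.sym eq) (All.lookup x∉ (∈-lookup i))
unique⇒lookup-injective (_  ∷ u) (suc i) (suc j) eq = cong suc (unique⇒lookup-injective u i j eq)

module _ {A B : Set} {R : A → B → Set} {xs : List A} {ys : List B} where

  length-≤-by-injective-relation :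
    Unique xs →
    All (λ x → ∃[ y ] y ∈ ys × R x y) xs →
    (∀ {x x′ y} → x ∈ xs → x′ ∈ xs → y ∈ ys → R x y → R x′ y → x ≡ x′) →
    length xs ≤ length ys
  length-≤-by-injective-relation unique total injective =
    injective⇒≤ {f = image-index} image-index-injective
    where
    image : Fin (length xs) → B
    image i = proj₁ (All.lookup total (∈-lookup i))

    image∈ys : ∀ i → image i ∈ ys
    image∈ys i = proj₁ (proj₂ (All.lookup total (∈-lookup i)))

    related : ∀ i → R (lookup xs i) (image i)
    related i = proj₂ (proj₂ (All.lookup total (∈-lookup i)))

    image-index : Fin (length xs) → Fin (length ys)
    image-index i = index (image∈ys i)

    image-index-injective : ∀ {i j} → image-index i ≡ image-index j → i ≡ j
    image-index-injective {i} {j} eq = unique⇒lookup-injective unique i j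
      (injective (∈-lookup i) (∈-lookup j) (image∈ys i) (related i)
        (≡.subst (R (lookup xs j)) (≡.sym same-image) (related j)))
      where
      same-image : image i ≡ image j
      same-image = index-injective (setoid B) (image∈ys i) (image∈ys j) eq

  -- Used where totality is only classical: Covers involves the undecidable relation Adj G.
  length-≤-by-¬¬-total-injective-relation :
    Unique xs →
    (∀ {x} → x ∈ xs → ¬ ¬ (∃[ y ] y ∈ ys × R x y)) →
    (∀ {x x′ y} → x ∈ xs → x′ ∈ xs → y ∈ ys → R x y → R x′ y → x ≡ x′) →
    length xs ≤ length ys
  length-≤-by-¬¬-total-injective-relation unique ¬¬total injective =
    decidable-stable (length xs ≤? length ys) λ ≰ →
      All.sequenceA 0ℓ (RawMonad.rawApplicative ¬¬-Monad) (All.tabulate ¬¬total)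
        λ total → ≰ (length-≤-by-injective-relation unique total injective)

module _ {n} (G : Graph n) where

  Covers-refl : ∀ e → Covers G e e
  Covers-refl (u , _) = u , u , inj₁ refl , inj₁ refl , inj₁ refl

  isInducedMatching⇒covers⇒≡ : ∀ {N e e′} → IsInducedMatching G N →
                               e ∈ N → e′ ∈ N → Covers G e e′ → e ≡ e′
  isInducedMatching⇒covers⇒≡ {e = e} {e′} ((_ , disjoint) , induced) e∈N e′∈N
                             (x , y , x∈e , y∈e′ , near)
    with ≡-dec Fin._≟_ Fin._≟_ e e′ | near
  ... | yes e≡e′ | _         = e≡e′
  ... | no  e≢e′ | inj₁ refl = contradiction y∈e′ (disjoint e∈N e′∈N e≢e′ x x∈e)
  ... | no  e≢e′ | inj₂ adj  = contradiction adj (induced e∈N e′∈N e≢e′ x y x∈e y∈e′)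

  isInducedMatching-∷ : ∀ {N f} → IsEdge G f → (∀ {e} → e ∈ N → ¬ Covers G f e) →
                        IsInducedMatching G N → IsInducedMatching G (f ∷ N)
  isInducedMatching-∷ {N} {f} f-edge uncovered (((edges , unique) , disjoint) , induced) =
    ((f-edge All.∷ edges , All.tabulate f∉N ∷ unique) , disjoint′) , induced′
    where
    f∉N : ∀ {e} → e ∈ N → f ≢ e
    f∉N e∈N refl = uncovered e∈N (Covers-refl f)

    disjoint′ : ∀ {e e′} → e ∈ f ∷ N → e′ ∈ f ∷ N → e ≢ e′ →
                ∀ x → x isEndOf e → ¬ (x isEndOf e′)
    disjoint′ (here refl) (here refl) e≢e′ = contradiction refl e≢e′
    disjoint′ (here refl) (there e′∈N) _ x x∈f x∈e′ =
      uncovered e′∈N (x , x , x∈f , x∈e′ , inj₁ refl)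
    disjoint′ (there e∈N) (here refl) _ x x∈e x∈f =
      uncovered e∈N (x , x , x∈f , x∈e , inj₁ refl)
    disjoint′ (there e∈N) (there e′∈N) = disjoint e∈N e′∈N

    induced′ : ∀ {e e′} → e ∈ f ∷ N → e′ ∈ f ∷ N → e ≢ e′ →
               ∀ x y → x isEndOf e → y isEndOf e′ → ¬ Adj G x y
    induced′ (here refl) (here refl) e≢e′ = contradiction refl e≢e′
    induced′ (here refl) (there e′∈N) _ x y x∈f y∈e′ adj =
      uncovered e′∈N (x , y , x∈f , y∈e′ , inj₂ adj)
    induced′ (there e∈N) (here refl) _ x y x∈e y∈f adj =
      uncovered e∈N (y , x , y∈f , x∈e , inj₂ (Graph.sym G adj))
    induced′ (there e∈N) (there e′∈N) = induced e∈N e′∈N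

  isMaximalInducedMatching⇒¬¬covered : ∀ {N f} → IsMaximalInducedMatching G N → IsEdge G f →
                                       ¬ ¬ (∃[ e ] e ∈ N × Covers G f e)
  isMaximalInducedMatching⇒¬¬covered {N} {f} (induced , maximal) f-edge uncovered =
    uncovered (f , f∈N , Covers-refl f)
    where
    f∈N : f ∈ N
    f∈N = maximal (f ∷ N)
      (isInducedMatching-∷ f-edge (λ e∈N f-covers-e → uncovered (_ , e∈N , f-covers-e)) induced)
      there (here refl)

  module _ {M : List (Pair n)} (covered : CoveredExactlyOnce G M) where

    length-inducedMatching-≤ : ∀ {N} → CoveredTogether G M → IsInducedMatching G N →
                               length N ≤ length M
    length-inducedMatching-≤ together induced@(((edges , unique) , _) , _) =
      length-≤-by-injective-relation {R = λ e f → Covers G f e} unique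
        (All.map (λ e-edge → proj₁ (covered _ e-edge)) edges)
        λ e∈N e′∈N f∈M f-covers-e f-covers-e′ →
          isInducedMatching⇒covers⇒≡ induced e∈N e′∈N
            (together _ _ _ f∈M (All.lookup edges e∈N) (All.lookup edges e′∈N)
              f-covers-e f-covers-e′)

    length-≤-maximalInducedMatching : ∀ {N} → IsEdgeSet G M → IsMaximalInducedMatching G N →
                                      length M ≤ length N
    length-≤-maximalInducedMatching (edgesM , uniqueM) maximal@((((edgesN , _) , _) , _) , _) =
      length-≤-by-¬¬-total-injective-relation {R = Covers G} uniqueM
        (λ f∈M → isMaximalInducedMatching⇒¬¬covered maximal (All.lookup edgesM f∈M))
        λ f∈M f′∈M e∈N → proj₂ (covered _ (All.lookup edgesN e∈N)) _ _ f∈M f′∈M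

lemma3p6 : ∀ {n} (G : Graph n) (M : List (Pair n)) →
    IsMatching G M → CoveredExactlyOnce G M → CoveredTogether G M →
    WellIndumatched G
lemma3p6 G M (edgeSet , _) covered together N N′ maximal maximal′ =
  trans (≡.sym (length-M≡ maximal)) (length-M≡ maximal′)
  where
  length-M≡ : ∀ {N} → IsMaximalInducedMatching G N → length M ≡ length N
  length-M≡ maximal@(induced , _) =
    ≤-antisym (length-≤-maximalInducedMatching G covered edgeSet maximal)
              (length-inducedMatching-≤ G covered together induced)
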